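{- Let $F=\langle W,R,\{S_x\}_{x\in W}\rangle$ be any $\mathbf{ILS}$-frame. Then $\mathbf{J2}$ is valid in $F$ if and only if $\mathbf{J4}$ is valid in $F$ and the following holds: for all $x,y\in W$, all $V\subseteq W$ and every family $(U_z)_{z\in V\cap R[x]}$ of subsets of $W$, if $yS_xV$ and $zS_xU_z$ for every $z\in V\cap R[x]$, then $yS_x\left(\bigcup_{z\in V\cap R[x]}U_z\right)$. Here $R[x]=\{y\in W: xRy\}$.
   Context: Formulas are built from propositional variables, $\top,\bot$, $\neg,\land,\lor,\to$, unary $\Box$ and binary $\rhd$; $\Diamond A$ abbreviates $\neg\Box\neg A$. Schemata: $\mathbf{J2}$: $(A\rhd B)\land(B\rhd C)\to A\rhd C$; $\mathbf{J4}$: $A\rhd B\to(\Diamond A\to\Diamond B)$. An $\mathbf{ILS}$-frame is a triple $\langle W,R,\{S_x\}_{x\in W}\rangle$ with $W$ nonempty, $R$ transitive and conversely well-founded on $W$, each $S_x\subseteq W\times(\mathcal P(W)\setminus\{\emptyset\})$ such that $yS_xV$ implies $xRy$, and (monotonicity) $yS_xV$ and $V\subseteq U$ imply $yS_xU$. Satisfaction: usual Boolean clauses, $x\Vdash\Box A$ iff $y\Vdash A$ for all $y$ with $xRy$, and $x\Vdash A\rhd B$ iff for every $y$ with $xRy$ and $y\Vdash A$ there is $V\subseteq W$ with $yS_xV$ and $z\Vdash B$ for all $z\in V$. A schema is valid in a frame if every instance holds at every point under every satisfaction relation. -}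

module Defs where

open import Data.Nat using (ℕ)
open import Data.Product using (Σ; _×_; ∃; _,_)
import Level
open import Level using (Lift)
open import Data.Unit.Polymorphic using (⊤)
open import Data.Empty.Polymorphic using (⊥)
open import Data.Sum using (_⊎_)
open import Relation.Nullary using (¬_)
open import Induction.WellFounded using (WellFounded)

Subset : Set → Set₁
Subset W = W → Set

_⊆_ : {W : Set} → Subset W → Subset W → Set
V ⊆ U = ∀ {w} → V w → U w

infixr 5 _⇒_
infixr 6 _∨'_
infixr 7 _∧'_
infix 8 _▷_
data Fm : Set where
  var  : ℕ → Fm
  ⊤'   : Fm
  ⊥'   : Fm
  ¬'_  : Fm → Fm
  _∧'_ : Fm → Fm → Fm
  _∨'_ : Fm → Fm → Fm
  _⇒_  : Fm → Fm → Fm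
  □_   : Fm → Fm
  _▷_  : Fm → Fm → Fm

◇_ : Fm → Fm
◇ A = ¬' (□ (¬' A))

-- ILS-frames.  S x y V  means  y S_x V.
record ILSFrame : Set₁ where
  field
    W        : Set
    R        : W → W → Set
    S        : W → W → Subset W → Set
    R-trans  : ∀ {x y z} → R x y → R y z → R x z
    R-cwf    : WellFounded (λ y x → R x y)
    S-R      : ∀ {x y V} → S x y V → R x y
    S-nonempty : ∀ {x y V} → S x y V → Σ W V
    S-mono   : ∀ {x y V U} → S x y V → V ⊆ U → S x y U

module _ (F : ILSFrame) where
  open ILSFrame F

  Valuation : Set₁
  Valuation = ℕ → Subset W

  -- satisfaction relation determined by a valuation
  -- (lives in Set₁ because ▷ quantifies over subsets of W)
  Sat : Valuation → W → Fm → Set₁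
  Sat v x (var p) = Lift (Level.suc Level.zero) (v p x)
  Sat v x ⊤' = ⊤
  Sat v x ⊥' = ⊥
  Sat v x (¬' A) = ¬ Sat v x A
  Sat v x (A ∧' B) = Sat v x A × Sat v x B
  Sat v x (A ∨' B) = Sat v x A ⊎ Sat v x B
  Sat v x (A ⇒ B) = Sat v x A → Sat v x B
  Sat v x (□ A) = ∀ y → R x y → Sat v y A
  Sat v x (A ▷ B) = ∀ y → R x y → Sat v y A →
                    Σ (Subset W) (λ V → Lift (Level.suc Level.zero) (S x y V) × (∀ z → V z → Sat v z B))

  ValidFm : Fm → Set₁
  ValidFm A = ∀ (v : Valuation) (x : W) → Sat v x A

J2-inst : Fm → Fm → Fm → Fm
J2-inst A B C = ((A ▷ B) ∧' (B ▷ C)) ⇒ (A ▷ C)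

J4-inst : Fm → Fm → Fm
J4-inst A B = (A ▷ B) ⇒ ((◇ A) ⇒ (◇ B))

J2-valid : ILSFrame → Set₁
J2-valid F = ∀ A B C → ValidFm F (J2-inst A B C)

J4-valid : ILSFrame → Set₁
J4-valid F = ∀ A B → ValidFm F (J4-inst A B)

UnionCondition : ILSFrame → Set₁
UnionCondition F =
  ∀ (x y : W) (V : Subset W) (U : W → Subset W) →
  S x y V →
  (∀ z → V z → R x z → S x z (U z)) →
  S x y (λ w → Σ W (λ z → V z × R x z × U z w))
  where open ILSFrame F

-- Three implications are proved separately, each uniformly in the frame.
--  * J2 ⟹ J4: instantiate J2 with C = ⊥.  From A ▷ B and B ▷ ⊥ (which holds
--    vacuously when □¬B) J2 gives A ▷ ⊥; since S-neighbourhoods are nonempty,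
--    no R-successor can satisfy A, so ¬◇A.
--  * J2 ⟹ union condition: interpret p₀ as {y}, p₁ as V and p₂ as the union;
--    then p₀ ▷ p₁ and p₁ ▷ p₂ hold at x, and J2 yields a set V' ⊆ ⋃ U_z
--    with y S_x V', whence y S_x ⋃ U_z by monotonicity.
--  * union condition ⟹ J2: given A ▷ B and B ▷ C at x and an A-successor y,
--    take the B-neighbourhood V of y and for each B-point z ∈ V ∩ R[x] the
--    C-neighbourhood chosen by B ▷ C; their union is a C-neighbourhood of y.
module Submission where

open import Defs
open import Data.Nat using (zero; suc)
open import Data.Product using (_×_; Σ; _,_; proj₁; proj₂)
open import Data.Empty using (⊥-elim)
open import Function.Bundles using (_⇔_; mk⇔)
open import Level using (lift; lower)
open import Relation.Binary.PropositionalEquality using (_≡_; refl)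

module _ (F : ILSFrame) where
  open ILSFrame F

  ⋃[_∩R_] : Subset W → W → (W → Subset W) → Subset W
  ⋃[ V ∩R x ] U = λ w → Σ W (λ z → V z × R x z × U z w)

  -- J2 with C = ⊥ turns A ▷ B into ¬◇B → ¬◇A, i.e. J4.
  J2⇒J4 : J2-valid F → J4-valid F
  J2⇒J4 j2 A B v x A▷B ◇A ¬◇B = ◇A □¬A
    where
      B▷⊥ : Sat F v x (B ▷ ⊥')
      B▷⊥ y xRy yB = ⊥-elim (¬◇B y xRy yB)

      -- An A-successor would have a nonempty S_x-neighbourhood of ⊥-points.
      □¬A : Sat F v x (□ (¬' A))
      □¬A y xRy yA with j2 A B ⊥' v x (A▷B , B▷⊥) y xRy yA
      ... | V , lift ySV , V⊥ = lower (V⊥ _ (proj₂ (S-nonempty ySV)))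

  -- Valuation 0 ↦ {y}, 1 ↦ V, 2 ↦ ⋃ U_z realises the union condition as
  -- an instance of J2.
  J2⇒Union : J2-valid F → UnionCondition F
  J2⇒Union j2 x y V U ySV zSU with j2 (var 0) (var 1) (var 2) v x (p₀▷p₁ , p₁▷p₂) y (S-R ySV) (lift refl)
    where
      v : Valuation F
      v zero          = λ w → w ≡ y
      v (suc zero)    = V
      v (suc (suc _)) = ⋃[ V ∩R x ] U

      p₀▷p₁ : Sat F v x (var 0 ▷ var 1)
      p₀▷p₁ .y _ (lift refl) = V , lift ySV , λ _ Vz → lift Vz

      p₁▷p₂ : Sat F v x (var 1 ▷ var 2)
      p₁▷p₂ z xRz (lift Vz) =
        U z , lift (zSU z Vz xRz) , λ w Uzw → lift (z , Vz , xRz , Uzw)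
  ... | V′ , lift ySV′ , V′⊆⋃ = S-mono ySV′ (λ {w} V′w → lower (V′⊆⋃ w V′w))

  -- Composing the witnesses of A ▷ B and B ▷ C through the union condition.
  Union⇒J2 : UnionCondition F → J2-valid F
  Union⇒J2 union A B C v x (A▷B , B▷C) y xRy yA with A▷B y xRy yA
  ... | V , lift ySV , VB = ⋃[ V ∩R x ] Cnbhd , lift (union x y V Cnbhd ySV zSCnbhd) , ⋃C
    where
      Cnbhd : W → Subset W
      Cnbhd z w = Σ (V z) (λ Vz → Σ (R x z) (λ xRz → proj₁ (B▷C z xRz (VB z Vz)) w))

      zSCnbhd : ∀ z → V z → R x z → S x z (Cnbhd z)
      zSCnbhd z Vz xRz =
        S-mono (lower (proj₁ (proj₂ (B▷C z xRz (VB z Vz))))) (λ w∈ → Vz , xRz , w∈)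

      ⋃C : ∀ w → ⋃[ V ∩R x ] Cnbhd w → Sat F v w C
      ⋃C w (z , _ , _ , Vz , xRz , w∈) = proj₂ (proj₂ (B▷C z xRz (VB z Vz))) w w∈

proposition3p16 : (F : ILSFrame) → J2-valid F ⇔ (J4-valid F × UnionCondition F)
proposition3p16 F =
  mk⇔ (λ j2 → J2⇒J4 F j2 , J2⇒Union F j2)
      (λ (_ , union) → Union⇒J2 F union)
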